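{- Let $h\ge 2$ and $n\ge 1$ be integers and let $H$ be an $h$-uniform hypergraph. If $H$ is $n$-e.c., then $H$ has at least $n2^{n-1}$ edges and at least $n+\ell$ vertices, where $\ell$ is the smallest positive integer such that $\binom{\ell}{h-1}\geq 2^n$.
   Context: A hypergraph $H=(V,E)$ consists of a finite vertex set $V$ and a collection $E$ of subsets of $V$ (edges); it is $h$-uniform if every edge has exactly $h$ vertices. For a positive integer $n$, an $h$-uniform hypergraph $H$ is $n$-existentially closed ($n$-e.c.) if for every set $S\subseteq V(H)$ with $|S|=n$ and every $T\subseteq S$, there is a set $X\subseteq V(H)\setminus S$ with $|X|=h-1$ such that $X\cup\{z\}$ is an edge of $H$ for every $z\in T$ and $X\cup\{s\}$ is not an edge of $H$ for every $s\in S\setminus T$. -}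

module Defs where

open import Data.Nat using (ℕ; _∸_)
open import Data.Fin.Subset as S using (Subset; ∣_∣; _∪_; _∩_; ⁅_⁆; _⊆_; _─_)
open import Data.List using (List)
open import Data.List.Relation.Unary.All using (All)
open import Data.List.Relation.Unary.Unique.Propositional using (Unique)
import Data.List.Membership.Propositional as LM
open import Data.Product using (Σ; _×_)
open import Relation.Binary.PropositionalEquality using (_≡_)
open import Relation.Nullary using (¬_)

record Hypergraph (v : ℕ) : Set where
  field
    edges  : List (Subset v)
    unique : Unique edges

open Hypergraph public

IsEdge : ∀ {v} → Hypergraph v → Subset v → Set
IsEdge H X = X LM.∈ edges H

numEdges : ∀ {v} → Hypergraph v → ℕ
numEdges H = Data.List.length (edges H)

Uniform : ∀ {v} → ℕ → Hypergraph v → Set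
Uniform h H = All (λ e → ∣ e ∣ ≡ h) (edges H)

ExistentiallyClosed : ∀ {v} → ℕ → ℕ → Hypergraph v → Set
ExistentiallyClosed {v} h n H =
  (S T : Subset v) → ∣ S ∣ ≡ n → T ⊆ S →
  Σ (Subset v) λ X →
    (X ∩ S ≡ S.⊥) × (∣ X ∣ ≡ h ∸ 1) ×
    (∀ z → z S.∈ T → IsEdge H (X ∪ ⁅ z ⁆)) ×
    (∀ s → s S.∈ (S ─ T) → ¬ IsEdge H (X ∪ ⁅ s ⁆))

-- Put the n-set S first, so the vertex set is Fin (n + m) with m = v − n. For every
-- T ⊆ S the e.c. property gives an (h − 1)-set X_T avoiding S, hence inside the last m
-- vertices, such that X_T ∪ {x} (x ∈ S) is an edge exactly when x ∈ T. So T ↦ X_T is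
-- injective, whence 2^n ≤ m C (h − 1) and m ≥ ℓ. Likewise (x, T) ↦ X_T ∪ {x} for x ∈ T
-- is injective into the edges, because x is the only vertex of S in that edge; there
-- are n 2^(n − 1) such pairs.
module Submission where

open import Defs
open import Data.Nat using (ℕ; zero; suc; _+_; _*_; _∸_; _^_; _≤_; _≥_; s≤s; z≤n)
open import Data.Nat.Properties
  using (+-identityʳ; +-monoʳ-≤; *-monoʳ-≤; ≤-refl; ≤-trans; <⇒≱; m^n>0; m≤n⇒∃[o]m+o≡n)
open import Data.Nat.Combinatorics using (_C_; nCk+nC[k+1]≡[n+1]C[k+1])
open import Data.Bool.Properties using (∧-identityʳ)
open import Data.Fin using (Fin; zero; suc; _↑ˡ_)
open import Data.Fin.Properties using (injective⇒≤)
open import Data.Fin.Subset as S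
  using (Subset; inside; outside; ∣_∣; _∪_; _∩_; ⁅_⁆; _⊆_; _─_; _∉_)
open import Data.Fin.Subset.Properties
  using (∣⊥∣≡0; ⊆-antisym; _∈?_; x∈⁅x⁆; x∈⁅y⁆⇒x≡y; ∪-identityʳ)
open import Data.List using (List; []; _∷_; map; length; lookup; allFin; cartesianProduct)
  renaming (_++_ to _++ᴸ_)
open import Data.List.Properties using (length-map; length-++; length-tabulate)
open import Data.List.Relation.Unary.All as All using ([])
open import Data.List.Relation.Unary.Any as Any using (here)
open import Data.List.Relation.Unary.Any.Properties using (lookup-index)
open import Data.List.Relation.Unary.AllPairs using ([]; _∷_)
open import Data.List.Relation.Unary.Unique.Propositional using (Unique)
import Data.List.Relation.Unary.Unique.Propositional.Properties as Unique
open import Data.List.Membership.Propositional using (_∈_)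
open import Data.List.Membership.Propositional.Properties
  using (∈-lookup; ∈-map⁻; ∈-map⁺; ∈-++⁺ˡ; ∈-++⁺ʳ)
open import Data.Vec as Vec using ([]; _∷_; _++_; here; there; insertAt; removeAt)
open import Data.Vec.Properties
  using ( ∷-injectiveˡ; ∷-injectiveʳ; ++-injectiveˡ; ++-injectiveʳ
        ; insertAt-lookup; removeAt-insertAt; lookup⇒[]=)
open import Data.Product using (_×_; _,_)
open import Data.Empty using (⊥; ⊥-elim)
open import Function.Definitions using (Injective)
open import Relation.Nullary using (¬_; yes; no; contradiction)
open import Relation.Binary.PropositionalEquality

private
  variable
    A B : Set
    n m : ℕ

Unique⇒lookup-injective : ∀ {xs : List A} → Unique xs → Injective _≡_ _≡_ (lookup xs)
Unique⇒lookup-injective (_ ∷ _) {zero} {zero} _ = refl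
Unique⇒lookup-injective (x∉ ∷ _) {zero} {suc j} eq = ⊥-elim (All.lookup x∉ (∈-lookup j) eq)
Unique⇒lookup-injective (x∉ ∷ _) {suc i} {zero} eq = ⊥-elim (All.lookup x∉ (∈-lookup i) (sym eq))
Unique⇒lookup-injective (_ ∷ u) {suc i} {suc j} eq = cong suc (Unique⇒lookup-injective u eq)

Unique∧⊆⇒length≤ : ∀ {xs ys : List A} → Unique xs → (∀ {x} → x ∈ xs → x ∈ ys) →
                   length xs ≤ length ys
Unique∧⊆⇒length≤ {xs = xs} {ys} u xs⊆ys = injective⇒≤ {f = position} position-injective
  where
  position : Fin (length xs) → Fin (length ys)
  position i = Any.index (xs⊆ys (∈-lookup i))

  position-injective : Injective _≡_ _≡_ position
  position-injective {i} {j} eq = Unique⇒lookup-injective u (begin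
    lookup xs i                  ≡⟨ lookup-index (xs⊆ys (∈-lookup i)) ⟩
    lookup ys (position i)       ≡⟨ cong (lookup ys) eq ⟩
    lookup ys (position j)       ≡⟨ lookup-index (xs⊆ys (∈-lookup j)) ⟨
    lookup xs j                  ∎)
    where open ≡-Reasoning

injection⇒length≤ : ∀ {xs : List A} {ys : List B} (f : A → B) →
  Unique xs → Injective _≡_ _≡_ f → (∀ x → f x ∈ ys) → length xs ≤ length ys
injection⇒length≤ {xs = xs} f u f-inj f∈ys =
  subst (_≤ _) (length-map f xs) (Unique∧⊆⇒length≤ (Unique.map⁺ f-inj u) image⊆ys)
  where
  image⊆ys : ∀ {y} → y ∈ map f xs → y ∈ _
  image⊆ys y∈ with ∈-map⁻ f y∈
  ... | x , _ , refl = f∈ys x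

length-cartesianProduct : (xs : List A) (ys : List B) →
  length (cartesianProduct xs ys) ≡ length xs * length ys
length-cartesianProduct [] ys = refl
length-cartesianProduct (x ∷ xs) ys = begin
  length (map (x ,_) ys ++ᴸ cartesianProduct xs ys)       ≡⟨ length-++ (map (x ,_) ys) ⟩
  length (map (x ,_) ys) + length (cartesianProduct xs ys)
    ≡⟨ cong₂ _+_ (length-map (x ,_) ys) (length-cartesianProduct xs ys) ⟩
  length ys + length xs * length ys                      ∎
  where open ≡-Reasoning

subsets : ∀ n → List (Subset n)
subsets zero    = [] ∷ []
subsets (suc n) = map (inside ∷_) (subsets n) ++ᴸ map (outside ∷_) (subsets n)

length-subsets : ∀ n → length (subsets n) ≡ 2 ^ n
length-subsets zero    = refl
length-subsets (suc n) = begin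
  length (map (inside ∷_) (subsets n) ++ᴸ map (outside ∷_) (subsets n))
    ≡⟨ length-++ (map (inside ∷_) (subsets n)) ⟩
  length (map (inside ∷_) (subsets n)) + length (map (outside ∷_) (subsets n))
    ≡⟨ cong₂ _+_ (length-map _ (subsets n)) (length-map _ (subsets n)) ⟩
  length (subsets n) + length (subsets n)
    ≡⟨ cong (λ k → k + k) (length-subsets n) ⟩
  2 ^ n + 2 ^ n
    ≡⟨ cong (2 ^ n +_) (+-identityʳ (2 ^ n)) ⟨
  2 ^ suc n ∎
  where open ≡-Reasoning

subsets-unique : ∀ n → Unique (subsets n)
subsets-unique zero    = [] ∷ []
subsets-unique (suc n) =
  Unique.++⁺ (Unique.map⁺ ∷-injectiveʳ (subsets-unique n))
             (Unique.map⁺ ∷-injectiveʳ (subsets-unique n))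
             disjoint
  where
  disjoint : ∀ {p} → p ∈ map (inside ∷_) (subsets n) × p ∈ map (outside ∷_) (subsets n) → ⊥
  disjoint (p∈₁ , p∈₂) with ∈-map⁻ _ p∈₁ | ∈-map⁻ _ p∈₂
  ... | _ , _ , refl | _ , _ , ()

subsetsOfSize : ∀ n → ℕ → List (Subset n)
subsetsOfSize zero    zero    = [] ∷ []
subsetsOfSize zero    (suc k) = []
subsetsOfSize (suc n) zero    = map (outside ∷_) (subsetsOfSize n zero)
subsetsOfSize (suc n) (suc k) =
  map (inside ∷_) (subsetsOfSize n k) ++ᴸ map (outside ∷_) (subsetsOfSize n (suc k))

length-subsetsOfSize : ∀ n k → length (subsetsOfSize n k) ≡ n C k
length-subsetsOfSize zero    zero    = refl
length-subsetsOfSize zero    (suc k) = refl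
length-subsetsOfSize (suc n) zero    =
  trans (length-map _ (subsetsOfSize n zero)) (length-subsetsOfSize n zero)
length-subsetsOfSize (suc n) (suc k) = begin
  length (map (inside ∷_) (subsetsOfSize n k) ++ᴸ map (outside ∷_) (subsetsOfSize n (suc k)))
    ≡⟨ length-++ (map (inside ∷_) (subsetsOfSize n k)) ⟩
  length (map (inside ∷_) (subsetsOfSize n k)) + length (map (outside ∷_) (subsetsOfSize n (suc k)))
    ≡⟨ cong₂ _+_ (length-map _ (subsetsOfSize n k)) (length-map _ (subsetsOfSize n (suc k))) ⟩
  length (subsetsOfSize n k) + length (subsetsOfSize n (suc k))
    ≡⟨ cong₂ _+_ (length-subsetsOfSize n k) (length-subsetsOfSize n (suc k)) ⟩
  n C k + n C suc k
    ≡⟨ nCk+nC[k+1]≡[n+1]C[k+1] n k ⟩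
  suc n C suc k ∎
  where open ≡-Reasoning

∈-subsetsOfSize : ∀ {n} (p : Subset n) → p ∈ subsetsOfSize n ∣ p ∣
∈-subsetsOfSize []             = here refl
∈-subsetsOfSize (inside ∷ p)   = ∈-++⁺ˡ (∈-map⁺ (inside ∷_) (∈-subsetsOfSize p))
∈-subsetsOfSize {suc n} (outside ∷ p) with ∣ p ∣ | ∈-subsetsOfSize p
... | zero  | p∈ = ∈-map⁺ (outside ∷_) p∈
... | suc k | p∈ = ∈-++⁺ʳ (map (inside ∷_) (subsetsOfSize n k)) (∈-map⁺ (outside ∷_) p∈)


∣⊤++⊥∣≡n : ∀ n → ∣ S.⊤ {n} ++ S.⊥ {m} ∣ ≡ n
∣⊤++⊥∣≡n {m} zero    = ∣⊥∣≡0 m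
∣⊤++⊥∣≡n     (suc n) = cong suc (∣⊤++⊥∣≡n n)

∣⊥++p∣≡∣p∣ : ∀ n (p : Subset m) → ∣ S.⊥ {n} ++ p ∣ ≡ ∣ p ∣
∣⊥++p∣≡∣p∣ zero    p = refl
∣⊥++p∣≡∣p∣ (suc n) p = ∣⊥++p∣≡∣p∣ n p

p++⊥⊆⊤++⊥ : ∀ (p : Subset n) → p ++ S.⊥ {m} ⊆ S.⊤ ++ S.⊥ {m}
p++⊥⊆⊤++⊥ []      x∈         = x∈
p++⊥⊆⊤++⊥ (_ ∷ p) here       = here
p++⊥⊆⊤++⊥ (_ ∷ p) (there x∈) = there (p++⊥⊆⊤++⊥ p x∈)

p++q∩⊤++⊥≡⊥⇒p≡⊥ : ∀ (p : Subset n) (q : Subset m) → (p ++ q) ∩ (S.⊤ ++ S.⊥ {m}) ≡ S.⊥ → p ≡ S.⊥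
p++q∩⊤++⊥≡⊥⇒p≡⊥ []      q eq = refl
p++q∩⊤++⊥≡⊥⇒p≡⊥ (x ∷ p) q eq =
  cong₂ _∷_ (trans (sym (∧-identityʳ x)) (∷-injectiveˡ eq)) (p++q∩⊤++⊥≡⊥⇒p≡⊥ p q (∷-injectiveʳ eq))

⊥++p∪⁅x↑ˡ⁆≡⁅x⁆++p : ∀ (x : Fin n) (p : Subset m) → (S.⊥ {n} ++ p) ∪ ⁅ x ↑ˡ m ⁆ ≡ ⁅ x ⁆ ++ p
⊥++p∪⁅x↑ˡ⁆≡⁅x⁆++p zero    p = cong (inside ∷_) (∪-identityʳ _)
⊥++p∪⁅x↑ˡ⁆≡⁅x⁆++p (suc x) p = cong (outside ∷_) (⊥++p∪⁅x↑ˡ⁆≡⁅x⁆++p x p)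

x∈p⇒x↑ˡ∈p++q : ∀ {x : Fin n} {p} {q : Subset m} → x S.∈ p → x ↑ˡ m S.∈ p ++ q
x∈p⇒x↑ˡ∈p++q here       = here
x∈p⇒x↑ˡ∈p++q (there x∈) = there (x∈p⇒x↑ˡ∈p++q x∈)

x∉p⇒x↑ˡ∈⊤++⊥─p++⊥ : ∀ {x : Fin n} {p} → x ∉ p → x ↑ˡ m S.∈ (S.⊤ ++ S.⊥ {m}) ─ (p ++ S.⊥)
x∉p⇒x↑ˡ∈⊤++⊥─p++⊥ {x = zero}  {outside ∷ p} x∉ = here
x∉p⇒x↑ˡ∈⊤++⊥─p++⊥ {x = zero}  {inside ∷ p}  x∉ = contradiction here x∉
x∉p⇒x↑ˡ∈⊤++⊥─p++⊥ {x = suc x} {_ ∷ p}       x∉ = there (x∉p⇒x↑ˡ∈⊤++⊥─p++⊥ (λ x∈ → x∉ (there x∈)))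

module _ (h : ℕ) (H : Hypergraph (n + m)) where

  record Separator (t : Subset n) : Set where
    field
      witness : Subset m
      size    : ∣ witness ∣ ≡ h ∸ 1
      edge    : ∀ {x} → x S.∈ t → IsEdge H (⁅ x ⁆ ++ witness)
      nonEdge : ∀ {x} → x ∉ t → ¬ IsEdge H (⁅ x ⁆ ++ witness)

  open Separator

  separator : ExistentiallyClosed h n H → ∀ t → Separator t
  separator ec t with ec (S.⊤ ++ S.⊥ {m}) (t ++ S.⊥) (∣⊤++⊥∣≡n n) (p++⊥⊆⊤++⊥ t)
  ... | X , X∩S≡⊥ , ∣X∣≡h∸1 , edges , nonEdges with Vec.splitAt n X
  ... | b , a , refl with p++q∩⊤++⊥≡⊥⇒p≡⊥ b a X∩S≡⊥
  ... | refl = record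
    { witness = a
    ; size    = trans (sym (∣⊥++p∣≡∣p∣ n a)) ∣X∣≡h∸1
    ; edge    = λ {x} x∈t → subst (IsEdge H) (⊥++p∪⁅x↑ˡ⁆≡⁅x⁆++p x a)
                               (edges (x ↑ˡ m) (x∈p⇒x↑ˡ∈p++q x∈t))
    ; nonEdge = λ {x} x∉t → subst (λ e → ¬ IsEdge H e) (⊥++p∪⁅x↑ˡ⁆≡⁅x⁆++p x a)
                               (nonEdges (x ↑ˡ m) (x∉p⇒x↑ˡ∈⊤++⊥─p++⊥ x∉t))
    }

  witness-injective : ∀ {s t} (σ : Separator s) (τ : Separator t) → witness σ ≡ witness τ → s ≡ t
  witness-injective σ τ eq = ⊆-antisym (included σ τ eq) (included τ σ (sym eq))
    where
    included : ∀ {s t} (σ : Separator s) (τ : Separator t) → witness σ ≡ witness τ → s ⊆ t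
    included {t = t} σ τ eq {x} x∈s with x ∈? t
    ... | yes x∈t = x∈t
    ... | no  x∉t =
      contradiction (subst (λ w → IsEdge H (⁅ x ⁆ ++ w)) eq (edge σ x∈s)) (nonEdge τ x∉t)

  ExistentiallyClosed⇒2^n≤mC[h∸1] : ExistentiallyClosed h n H → 2 ^ n ≤ m C (h ∸ 1)
  ExistentiallyClosed⇒2^n≤mC[h∸1] ec =
    subst₂ _≤_ (length-subsets n) (length-subsetsOfSize m (h ∸ 1))
      (injection⇒length≤ (λ t → witness (separator ec t)) (subsets-unique n)
        (witness-injective (separator ec _) (separator ec _))
        witness∈subsetsOfSize)
    where
    witness∈subsetsOfSize : ∀ t → witness (separator ec t) ∈ subsetsOfSize m (h ∸ 1)
    witness∈subsetsOfSize t =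
      subst (λ k → witness (separator ec t) ∈ subsetsOfSize m k) (size (separator ec t))
        (∈-subsetsOfSize (witness (separator ec t)))

ExistentiallyClosed⇒[1+k]2^k≤numEdges : ∀ {k} h (H : Hypergraph (suc k + m)) →
  ExistentiallyClosed h (suc k) H → suc k * 2 ^ k ≤ numEdges H
ExistentiallyClosed⇒[1+k]2^k≤numEdges {m} {k} h H ec =
  subst (_≤ numEdges H) pairs-count
    (injection⇒length≤ edgeThrough pairs-unique edgeThrough-injective edgeThrough∈edges)
  where
  open Separator

  pairs : List (Fin (suc k) × Subset k)
  pairs = cartesianProduct (allFin (suc k)) (subsets k)

  pairs-unique : Unique pairs
  pairs-unique = Unique.cartesianProduct⁺ (Unique.allFin⁺ (suc k)) (subsets-unique k)

  pairs-count : length pairs ≡ suc k * 2 ^ k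
  pairs-count = trans (length-cartesianProduct (allFin (suc k)) (subsets k))
    (cong₂ _*_ (length-tabulate {n = suc k} (λ x → x)) (length-subsets k))

  extendAt : Fin (suc k) × Subset k → Subset (suc k)
  extendAt (x , p) = insertAt p x inside

  separatorThrough : ∀ xp → Separator h H (extendAt xp)
  separatorThrough xp = separator h H ec (extendAt xp)

  edgeThrough : Fin (suc k) × Subset k → Subset (suc k + m)
  edgeThrough (x , p) = ⁅ x ⁆ ++ witness (separatorThrough (x , p))

  edgeThrough∈edges : ∀ xp → edgeThrough xp ∈ edges H
  edgeThrough∈edges (x , p) =
    edge (separatorThrough (x , p)) (lookup⇒[]= x _ (insertAt-lookup p x inside))

  edgeThrough-injective : Injective _≡_ _≡_ edgeThrough
  edgeThrough-injective {x , p} {y , q} eq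
    with x∈⁅y⁆⇒x≡y y (subst (x S.∈_) (++-injectiveˡ ⁅ x ⁆ ⁅ y ⁆ eq) (x∈⁅x⁆ x))
  ... | refl = cong (x ,_) (begin
    p                              ≡⟨ removeAt-insertAt p x inside ⟨
    removeAt (insertAt p x inside) x
      ≡⟨ cong (λ t → removeAt t x)
           (witness-injective h H (separatorThrough (x , p)) (separatorThrough (x , q))
             (++-injectiveʳ ⁅ x ⁆ ⁅ x ⁆ eq)) ⟩
    removeAt (insertAt q x inside) x ≡⟨ removeAt-insertAt q x inside ⟩
    q                              ∎)
    where open ≡-Reasoning

0Ck≤1 : ∀ k → 0 C k ≤ 1
0Ck≤1 zero    = ≤-refl
0Ck≤1 (suc k) = z≤n

2^[1+k]≤mCj⇒1≤m : ∀ {m} k j → 2 ^ suc k ≤ m C j → 1 ≤ m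
2^[1+k]≤mCj⇒1≤m {zero}  k j 2^[1+k]≤0Cj =
  contradiction (≤-trans 2^[1+k]≤0Cj (0Ck≤1 j)) (<⇒≱ (*-monoʳ-≤ 2 (m^n>0 2 k)))
2^[1+k]≤mCj⇒1≤m {suc m} k j _ = s≤s z≤n

theorem3 : (h n v : ℕ) → h ≥ 2 → n ≥ 1 → (H : Hypergraph v) →
    Uniform h H → n ≤ v → ExistentiallyClosed h n H →
    (ℓ : ℕ) → 1 ≤ ℓ → ℓ C (h ∸ 1) ≥ 2 ^ n →
    ((m : ℕ) → 1 ≤ m → m C (h ∸ 1) ≥ 2 ^ n → ℓ ≤ m) →
    (numEdges H ≥ n * 2 ^ (n ∸ 1)) × (v ≥ n + ℓ)
theorem3 h (suc k) v _ (s≤s z≤n) H _ n≤v ec ℓ _ _ ℓ-minimal with m≤n⇒∃[o]m+o≡n n≤v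
... | m , refl =
  ExistentiallyClosed⇒[1+k]2^k≤numEdges h H ec ,
  +-monoʳ-≤ (suc k) (ℓ-minimal m 1≤m 2^n≤mC[h∸1])
  where
  2^n≤mC[h∸1] : 2 ^ suc k ≤ m C (h ∸ 1)
  2^n≤mC[h∸1] = ExistentiallyClosed⇒2^n≤mC[h∸1] h H ec

  1≤m : 1 ≤ m
  1≤m = 2^[1+k]≤mCj⇒1≤m k (h ∸ 1) 2^n≤mC[h∸1]
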